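{- For all integers $r,t\ge 3$, $\gamma_o(C_{r}\Box C_{t})\ge \gamma_o(C_r)\gamma_o(C_t).$
   Context: All graphs are finite and simple; $C_n$ is the cycle on $n$ vertices. For a graph with vertex set $V$, a vertex $v$ and $S\subseteq V$, let $\delta_S(v)=|N(v)\cap S|$ and $\overline{S}=V\setminus S$. A nonempty set $S\subseteq V$ is a global offensive alliance if $\delta_S(v)\ge \delta_{\overline{S}}(v)+1$ for every $v\in\overline{S}$; $\gamma_o(G)$ is the minimum cardinality of a global offensive alliance of $G$. $G\Box H$ is the Cartesian product: vertex set $V(G)\times V(H)$, with $(a,b)\sim(c,d)$ iff ($a=c$ and $b\sim d$ in $H$) or ($a\sim c$ in $G$ and $b=d$). -}

module Defs where

open import Data.Nat using (ℕ; zero; suc; _+_; _*_; _∸_; _≤_; _<_)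
open import Data.Nat as ℕ using ()
open import Data.Bool using (Bool; true; false; _∧_; _∨_; if_then_else_)
open import Data.Fin using (Fin; toℕ; remQuot; _≟_)
open import Data.Fin.Subset using (Subset; ∣_∣; _∉_; Nonempty)
open import Data.Product using (_×_; _,_; Σ)
open import Relation.Binary.PropositionalEquality using (_≡_)
open import Data.Vec using (lookup)
open import Relation.Nullary.Decidable using (⌊_⌋)

-- A finite (simple) graph on the vertex set Fin n, given by a Boolean
-- adjacency relation.  (The concrete graphs used below, C_n for n ≥ 3 and
-- their Cartesian products, are simple: symmetric and loopless.)
record Graph : Set where
  field
    order : ℕ
    adj   : Fin order → Fin order → Bool
open Graph public

count : ∀ {n} → (Fin n → Bool) → ℕ
count {zero}  f = 0
count {suc n} f = (if f Data.Fin.zero then 1 else 0) + count (λ i → f (Data.Fin.suc i))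

δ : (G : Graph) → Subset (order G) → Fin (order G) → ℕ
δ G S v = count (λ u → adj G v u ∧ lookup S u)

∁ : ∀ {n} → Subset n → Subset n
∁ = Data.Fin.Subset.∁

IsGOA : (G : Graph) → Subset (order G) → Set
IsGOA G S = Nonempty S × (∀ v → v ∉ S → δ G (∁ S) v + 1 ≤ δ G S v)

IsGammaO : Graph → ℕ → Set
IsGammaO G k = (Σ (Subset (order G)) λ S → IsGOA G S × ∣ S ∣ ≡ k)
             × (∀ S → IsGOA G S → k ≤ ∣ S ∣)

_==_ : ℕ → ℕ → Bool
m == n = ⌊ m ℕ.≟ n ⌋

-- The cycle C_n on vertices 0,…,n-1: i ~ j iff j ≡ i+1 (mod n) or i ≡ j+1 (mod n).
-- (Meant for n ≥ 3, where this is the usual simple cycle.)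
C : ℕ → Graph
C n = record
  { order = n
  ; adj   = λ i j → succ (toℕ i) == toℕ j ∨ succ (toℕ j) == toℕ i }
  where
  succ : ℕ → ℕ
  succ a = if suc a == n then 0 else suc a

-- Cartesian product G □ H, vertex set Fin (|G| * |H|) ≅ Fin |G| × Fin |H| via remQuot.
_□_ : Graph → Graph → Graph
G □ H = record
  { order = order G * order H
  ; adj   = λ x y → go (remQuot (order H) x) (remQuot (order H) y) }
  where
  go : Fin (order G) × Fin (order H) → Fin (order G) × Fin (order H) → Bool
  go (a , b) (c , d) = (⌊ a ≟ c ⌋ ∧ adj H b d) ∨ (adj G a c ∧ ⌊ b ≟ d ⌋)

-- A global offensive alliance S of the 4-regular torus C_r □ C_t leaves every
-- vertex outside S with at least 3 of its 4 neighbours in S, while a vertex of S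
-- has at most 4 neighbours outside S.  Counting the edges between S and its
-- complement both ways gives 3 (rt − |S|) ≤ 4 |S|, so γ_o(C_r □ C_t) ≥ 3rt/7.
-- In the other direction the even-indexed vertices of C_n form a global
-- offensive alliance, so γ_o(C_n) ≤ ⌈n/2⌉, and ⌈r/2⌉ ⌈t/2⌉ ≤ ⌈3rt/7⌉ for r, t ≥ 3.

module Submission where

open import Defs
open import Data.Nat
  using (ℕ; zero; suc; pred; _+_; _*_; _≤_; _<_; z≤n; s≤s; z<s; s≤s⁻¹; ⌊_/2⌋; ⌈_/2⌉)
open import Data.Nat.Properties
  using ( ≤-trans; ≤-reflexive; <-irrefl; ≮⇒≥; _<?_; <⇒≤; <⇒≢; ≤∧≢⇒<
        ; n≤1+n; n<1+n; m<1+n⇒m≤n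
        ; suc-injective; 1+n≢n; m≢1+n+m; m≤m+n; m≤n+m; m+[n∸m]≡n
        ; +-comm; +-assoc; +-identityʳ; *-comm; *-assoc; *-identityˡ; *-identityʳ; *-zeroʳ; *-suc
        ; *-distribˡ-+; *-distribʳ-+; +-mono-≤; +-monoʳ-≤; +-monoʳ-<; +-monoˡ-<
        ; *-mono-≤; *-monoˡ-≤; *-monoʳ-≤; *-cancelˡ-<; ⌊n/2⌋≤⌈n/2⌉; ⌊n/2⌋+⌈n/2⌉≡n
        ; +-*-semiring; module ≤-Reasoning )
import Data.Nat.Properties as ℕ
open import Data.Nat.Tactic.RingSolver using (solve-∀)
open import Data.Bool using (Bool; true; false; not; _∧_; _∨_; if_then_else_)
open import Data.Bool.Properties using (∨-comm; ∧-zeroʳ; not-involutive)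
open import Data.Fin using (Fin; zero; suc; toℕ; fromℕ<; remQuot; combine; _↑ˡ_; _↑ʳ_; _≟_)
open import Data.Fin.Properties using (toℕ<n; toℕ-fromℕ<; toℕ-injective; remQuot-combine)
open import Data.Fin.Subset using (Subset; ∣_∣; _∈_; _∉_)
open import Data.Fin.Subset.Properties using (x∈∁p⇒x∉p; ∣∁p∣≡n∸∣p∣; ∣p∣≤n)
open import Data.Vec using ([]; _∷_; lookup; tabulate; here)
open import Data.Vec.Properties using (lookup⇒[]=; []=⇒lookup; lookup-map; lookup∘tabulate)
open import Data.Product using (_,_; proj₁; proj₂; uncurry)
open import Data.Sum using (_⊎_; inj₁; inj₂)
open import Function using (_∘_; _⇔_; mk⇔)
open import Relation.Binary.PropositionalEquality
  using (_≡_; _≢_; _≗_; refl; sym; trans; cong; cong₂; subst; module ≡-Reasoning)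
open import Relation.Nullary using (Dec; yes; no; contradiction)
open import Relation.Nullary.Decidable using (⌊_⌋; ⌊⌋-map′; isYes≗does; does-⇔; dec-false)
open import Algebra.Properties.Semiring.Sum +-*-semiring
  using ( sum; sum-syntax; sum-cong-≗; sum-replicate-zero; ∑-comm; ∑-distrib-+
        ; *-distribˡ-sum; *-distribʳ-sum )

⌊⌋-⇔ : ∀ {A B : Set} → A ⇔ B → (a? : Dec A) (b? : Dec B) → ⌊ a? ⌋ ≡ ⌊ b? ⌋
⌊⌋-⇔ A⇔B a? b? = trans (isYes≗does a?) (trans (does-⇔ A⇔B a? b?) (sym (isYes≗does b?)))

⌊⌋-∨ : ∀ {A B : Set} (a? : Dec A) (b? : Dec B) → ⌊ a? ⌋ ∨ ⌊ b? ⌋ ≡ true → A ⊎ B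
⌊⌋-∨ (yes a) _       _  = inj₁ a
⌊⌋-∨ (no _)  (yes b) _  = inj₂ b
⌊⌋-∨ (no _)  (no _)  ()

≢⇒==false : ∀ {m n} → m ≢ n → (m == n) ≡ false
≢⇒==false {m} {n} m≢n = trans (isYes≗does (m ℕ.≟ n)) (dec-false (m ℕ.≟ n) m≢n)

⌊≟⌋-sym : ∀ {n} (a b : Fin n) → ⌊ a ≟ b ⌋ ≡ ⌊ b ≟ a ⌋
⌊≟⌋-sym a b = ⌊⌋-⇔ (mk⇔ sym sym) (a ≟ b) (b ≟ a)

𝟙 : Bool → ℕ
𝟙 b = if b then 1 else 0

𝟙-∧ : ∀ x y → 𝟙 (x ∧ y) ≡ 𝟙 x * 𝟙 y
𝟙-∧ true  y = sym (+-identityʳ (𝟙 y))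
𝟙-∧ false y = refl

𝟙-∨ : ∀ x y → x ∧ y ≡ false → 𝟙 (x ∨ y) ≡ 𝟙 x + 𝟙 y
𝟙-∨ true  false _ = refl
𝟙-∨ false y     _ = refl

𝟙-∧-split : ∀ x y → 𝟙 (x ∧ y) + 𝟙 (x ∧ not y) ≡ 𝟙 x
𝟙-∧-split false y     = refl
𝟙-∧-split true  true  = refl
𝟙-∧-split true  false = refl

𝟙-weight-≤ : ∀ {a b} x → (x ≡ true → a ≤ b) → a * 𝟙 x ≤ b * 𝟙 x
𝟙-weight-≤         true  a≤b = *-monoˡ-≤ 1 (a≤b refl)
𝟙-weight-≤ {a} {b} false _   = ≤-reflexive (trans (*-zeroʳ a) (sym (*-zeroʳ b)))

∑-mono-≤ : ∀ {n} {f g : Fin n → ℕ} → (∀ i → f i ≤ g i) → sum f ≤ sum g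
∑-mono-≤ {zero}  f≤g = z≤n
∑-mono-≤ {suc n} f≤g = +-mono-≤ (f≤g zero) (∑-mono-≤ (f≤g ∘ suc))

∑-sift : ∀ {n} (k : Fin n) (f : Fin n → ℕ) → ∑[ j < n ] (𝟙 ⌊ k ≟ j ⌋ * f j) ≡ f k
∑-sift {suc n} zero    f =
  trans (cong₂ _+_ (*-identityˡ (f zero)) (sum-replicate-zero n)) (+-identityʳ (f zero))
∑-sift {suc n} (suc k) f =
  trans (sum-cong-≗ λ j → cong (λ b → 𝟙 b * f (suc j)) (⌊⌋-map′ _ _ (k ≟ j)))
        (∑-sift k (f ∘ suc))

∑-↑ : ∀ m n (f : Fin (m + n) → ℕ) →
      sum f ≡ ∑[ i < m ] f (i ↑ˡ n) + ∑[ j < n ] f (m ↑ʳ j)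
∑-↑ zero    n f = refl
∑-↑ (suc m) n f = trans (cong (f zero +_) (∑-↑ m n (f ∘ suc))) (sym (+-assoc (f zero) _ _))

∑-combine : ∀ m n (f : Fin (m * n) → ℕ) → sum f ≡ ∑[ i < m ] ∑[ j < n ] f (combine i j)
∑-combine zero    n f = refl
∑-combine (suc m) n f =
  trans (∑-↑ n (m * n) f) (cong (sum (λ j → f (j ↑ˡ (m * n))) +_) (∑-combine m n (f ∘ (n ↑ʳ_))))

∑-remQuot : ∀ m n (g : Fin m → Fin n → ℕ) →
            ∑[ x < m * n ] uncurry g (remQuot n x) ≡ ∑[ i < m ] ∑[ j < n ] g i j
∑-remQuot m n g =
  trans (∑-combine m n _) (sum-cong-≗ λ i → sum-cong-≗ λ j → cong (uncurry g) (remQuot-combine i j))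

count≡∑𝟙 : ∀ {n} (f : Fin n → Bool) → count f ≡ ∑[ i < n ] 𝟙 (f i)
count≡∑𝟙 {zero}  f = refl
count≡∑𝟙 {suc n} f = cong (𝟙 (f zero) +_) (count≡∑𝟙 (f ∘ suc))

count-cong : ∀ {n} {f g : Fin n → Bool} → f ≗ g → count f ≡ count g
count-cong {zero}  f≗g = refl
count-cong {suc n} f≗g = cong₂ (λ b c → 𝟙 b + c) (f≗g zero) (count-cong (f≗g ∘ suc))

count-false : ∀ {n} {f : Fin n → Bool} → (∀ i → f i ≡ false) → count f ≡ 0
count-false {zero}  f≡false = refl
count-false {suc n} f≡false rewrite f≡false zero = count-false (f≡false ∘ suc)

count-∨ : ∀ {n} (f g : Fin n → Bool) → (∀ i → f i ∧ g i ≡ false) →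
          count (λ i → f i ∨ g i) ≡ count f + count g
count-∨ {n} f g disjoint = begin
  count (λ i → f i ∨ g i)
    ≡⟨ count≡∑𝟙 (λ i → f i ∨ g i) ⟩
  ∑[ i < n ] 𝟙 (f i ∨ g i)
    ≡⟨ sum-cong-≗ (λ i → 𝟙-∨ (f i) (g i) (disjoint i)) ⟩
  ∑[ i < n ] (𝟙 (f i) + 𝟙 (g i))
    ≡⟨ ∑-distrib-+ (𝟙 ∘ f) (𝟙 ∘ g) ⟩
  ∑[ i < n ] 𝟙 (f i) + ∑[ i < n ] 𝟙 (g i)
    ≡⟨ sym (cong₂ _+_ (count≡∑𝟙 f) (count≡∑𝟙 g)) ⟩
  count f + count g ∎
  where open ≡-Reasoning

count-≟ : ∀ {n} (k : Fin n) → count (λ j → ⌊ k ≟ j ⌋) ≡ 1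
count-≟ {n} k = begin
  count (λ j → ⌊ k ≟ j ⌋)          ≡⟨ count≡∑𝟙 (λ j → ⌊ k ≟ j ⌋) ⟩
  ∑[ j < n ] 𝟙 ⌊ k ≟ j ⌋           ≡⟨ sum-cong-≗ (λ j → sym (*-identityʳ (𝟙 ⌊ k ≟ j ⌋))) ⟩
  ∑[ j < n ] (𝟙 ⌊ k ≟ j ⌋ * 1)     ≡⟨ ∑-sift k (λ _ → 1) ⟩
  1                                ∎
  where open ≡-Reasoning

count-≟-∨ : ∀ {n} {a b : Fin n} → a ≢ b →
            count (λ j → ⌊ a ≟ j ⌋ ∨ ⌊ b ≟ j ⌋) ≡ 2
count-≟-∨ {a = a} {b} a≢b =
  trans (count-∨ (λ j → ⌊ a ≟ j ⌋) (λ j → ⌊ b ≟ j ⌋) disjoint) (cong₂ _+_ (count-≟ a) (count-≟ b))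
  where
  disjoint : ∀ j → ⌊ a ≟ j ⌋ ∧ ⌊ b ≟ j ⌋ ≡ false
  disjoint j with a ≟ j | b ≟ j
  ... | yes refl | yes refl = contradiction refl a≢b
  ... | yes _    | no _     = refl
  ... | no _     | _        = refl

∣p∣≡count : ∀ {n} (p : Subset n) → ∣ p ∣ ≡ count (lookup p)
∣p∣≡count []          = refl
∣p∣≡count (true ∷ p)  = cong suc (∣p∣≡count p)
∣p∣≡count (false ∷ p) = ∣p∣≡count p

∣p∣+∣∁p∣≡n : ∀ {n} (p : Subset n) → ∣ p ∣ + ∣ ∁ p ∣ ≡ n
∣p∣+∣∁p∣≡n p = trans (cong (∣ p ∣ +_) (∣∁p∣≡n∸∣p∣ p)) (m+[n∸m]≡n (∣p∣≤n p))

⌊m+n/2⌋<m : ∀ {m n} → n < m → ⌊ m + n /2⌋ < m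
⌊m+n/2⌋<m {m} {n} n<m with ⌊ m + n /2⌋ <? m
... | yes h<m = h<m
... | no  h≮m = contradiction m+n<m+n (<-irrefl refl)
  where
  open ≤-Reasoning
  h = ⌊ m + n /2⌋
  m≤h = ≮⇒≥ h≮m
  m+n<m+n : m + n < m + n
  m+n<m+n = begin-strict
    m + n           <⟨ +-monoʳ-< m n<m ⟩
    m + m           ≤⟨ +-mono-≤ m≤h m≤h ⟩
    h + h           ≤⟨ +-monoʳ-≤ h (⌊n/2⌋≤⌈n/2⌉ (m + n)) ⟩
    h + ⌈ m + n /2⌉ ≡⟨ ⌊n/2⌋+⌈n/2⌉≡n (m + n) ⟩
    m + n           ∎

degree : (G : Graph) → Fin (order G) → ℕ
degree G v = count (adj G v)

Symmetric : Graph → Set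
Symmetric G = ∀ u v → adj G u v ≡ adj G v u

Loopless : Graph → Set
Loopless G = ∀ v → adj G v v ≡ false

Regular : ℕ → Graph → Set
Regular k G = ∀ v → degree G v ≡ k

module _ (G : Graph) where

  private
    n = order G

  δ+δ∁≡degree : ∀ S v → δ G S v + δ G (∁ S) v ≡ degree G v
  δ+δ∁≡degree S v = begin
    δ G S v + δ G (∁ S) v
      ≡⟨ cong₂ _+_ (count≡∑𝟙 (edge-to S)) (count≡∑𝟙 (edge-to (∁ S))) ⟩
    ∑[ u < n ] 𝟙 (edge-to S u) + ∑[ u < n ] 𝟙 (edge-to (∁ S) u)
      ≡⟨ sym (∑-distrib-+ (𝟙 ∘ edge-to S) (𝟙 ∘ edge-to (∁ S))) ⟩
    ∑[ u < n ] (𝟙 (edge-to S u) + 𝟙 (edge-to (∁ S) u))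
      ≡⟨ sum-cong-≗ split ⟩
    ∑[ u < n ] 𝟙 (adj G v u)
      ≡⟨ sym (count≡∑𝟙 (adj G v)) ⟩
    degree G v ∎
    where
    open ≡-Reasoning
    edge-to : Subset n → Fin n → Bool
    edge-to T u = adj G v u ∧ lookup T u
    split : ∀ u → 𝟙 (edge-to S u) + 𝟙 (edge-to (∁ S) u) ≡ 𝟙 (adj G v u)
    split u = trans (cong (λ s → 𝟙 (edge-to S u) + 𝟙 (adj G v u ∧ s)) (lookup-map u not S))
                    (𝟙-∧-split (adj G v u) (lookup S u))

  ∑-δ≡∑∑ : ∀ S T → ∑[ v < n ] (δ G S v * 𝟙 (lookup T v))
                 ≡ ∑[ v < n ] ∑[ u < n ] (𝟙 (adj G v u ∧ lookup S u) * 𝟙 (lookup T v))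
  ∑-δ≡∑∑ S T = sum-cong-≗ λ v →
    trans (cong (_* 𝟙 (lookup T v)) (count≡∑𝟙 (λ u → adj G v u ∧ lookup S u)))
          (*-distribʳ-sum (𝟙 (lookup T v)) (λ u → 𝟙 (adj G v u ∧ lookup S u)))

  -- Both sides count the edges between S and T.
  ∑-δ-swap : Symmetric G → ∀ S T →
             ∑[ v < n ] (δ G S v * 𝟙 (lookup T v)) ≡ ∑[ u < n ] (δ G T u * 𝟙 (lookup S u))
  ∑-δ-swap adj-sym S T = begin
    ∑[ v < n ] (δ G S v * 𝟙 (lookup T v))
      ≡⟨ ∑-δ≡∑∑ S T ⟩
    ∑[ v < n ] ∑[ u < n ] (𝟙 (adj G v u ∧ lookup S u) * 𝟙 (lookup T v))
      ≡⟨ sum-cong-≗ (λ v → sum-cong-≗ λ u → swap v u) ⟩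
    ∑[ v < n ] ∑[ u < n ] (𝟙 (adj G u v ∧ lookup T v) * 𝟙 (lookup S u))
      ≡⟨ ∑-comm (λ v u → 𝟙 (adj G u v ∧ lookup T v) * 𝟙 (lookup S u)) ⟩
    ∑[ u < n ] ∑[ v < n ] (𝟙 (adj G u v ∧ lookup T v) * 𝟙 (lookup S u))
      ≡⟨ sym (∑-δ≡∑∑ T S) ⟩
    ∑[ u < n ] (δ G T u * 𝟙 (lookup S u)) ∎
    where
    open ≡-Reasoning
    𝟙-swap : ∀ a s t → 𝟙 (a ∧ s) * 𝟙 t ≡ 𝟙 (a ∧ t) * 𝟙 s
    𝟙-swap false s t = refl
    𝟙-swap true  s t = *-comm (𝟙 s) (𝟙 t)
    swap : ∀ v u → 𝟙 (adj G v u ∧ lookup S u) * 𝟙 (lookup T v)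
                 ≡ 𝟙 (adj G u v ∧ lookup T v) * 𝟙 (lookup S u)
    swap v u = trans (𝟙-swap (adj G v u) _ _)
                     (cong (λ a → 𝟙 (a ∧ lookup T v) * 𝟙 (lookup S u)) (adj-sym v u))

  double-count : Symmetric G → ∀ S T {m M} →
                 (∀ v → v ∈ T → m ≤ δ G S v) → (∀ u → u ∈ S → δ G T u ≤ M) →
                 m * ∣ T ∣ ≤ M * ∣ S ∣
  double-count adj-sym S T {m} {M} T⇒m≤δ S⇒δ≤M = begin
    m * ∣ T ∣
      ≡⟨ cong (m *_) (∣p∣≡∑𝟙 T) ⟩
    m * ∑[ v < n ] 𝟙 (lookup T v)
      ≡⟨ *-distribˡ-sum m (𝟙 ∘ lookup T) ⟩
    ∑[ v < n ] (m * 𝟙 (lookup T v))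
      ≤⟨ ∑-mono-≤ (λ v → 𝟙-weight-≤ (lookup T v) (T⇒m≤δ v ∘ lookup⇒[]= v T)) ⟩
    ∑[ v < n ] (δ G S v * 𝟙 (lookup T v))
      ≡⟨ ∑-δ-swap adj-sym S T ⟩
    ∑[ u < n ] (δ G T u * 𝟙 (lookup S u))
      ≤⟨ ∑-mono-≤ (λ u → 𝟙-weight-≤ (lookup S u) (S⇒δ≤M u ∘ lookup⇒[]= u S)) ⟩
    ∑[ u < n ] (M * 𝟙 (lookup S u))
      ≡⟨ sym (*-distribˡ-sum M (𝟙 ∘ lookup S)) ⟩
    M * ∑[ u < n ] 𝟙 (lookup S u)
      ≡⟨ cong (M *_) (sym (∣p∣≡∑𝟙 S)) ⟩
    M * ∣ S ∣ ∎
    where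
    open ≤-Reasoning
    ∣p∣≡∑𝟙 : ∀ p → ∣ p ∣ ≡ ∑[ i < n ] 𝟙 (lookup p i)
    ∣p∣≡∑𝟙 p = trans (∣p∣≡count p) (count≡∑𝟙 (lookup p))

  ∁-independent⇒offensive : ∀ S → (∀ v → v ∉ S → 0 < degree G v) →
                            (∀ v u → v ∉ S → adj G v u ≡ true → u ∈ S) →
                            ∀ v → v ∉ S → δ G (∁ S) v + 1 ≤ δ G S v
  ∁-independent⇒offensive S degree-pos neighbours-in-S v v∉S = begin
    δ G (∁ S) v + 1       ≡⟨ cong (_+ 1) δ∁≡0 ⟩
    1                     ≤⟨ degree-pos v v∉S ⟩
    degree G v            ≡⟨ sym (δ+δ∁≡degree S v) ⟩
    δ G S v + δ G (∁ S) v ≡⟨ cong (δ G S v +_) δ∁≡0 ⟩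
    δ G S v + 0           ≡⟨ +-identityʳ (δ G S v) ⟩
    δ G S v               ∎
    where
    open ≤-Reasoning
    no-edge : ∀ u → adj G v u ∧ lookup (∁ S) u ≡ false
    no-edge u with adj G v u in e
    ... | false = refl
    ... | true  = trans (lookup-map u not S) (cong not ([]=⇒lookup (neighbours-in-S v u v∉S e)))
    δ∁≡0 : δ G (∁ S) v ≡ 0
    δ∁≡0 = count-false no-edge

  regular-GOA-bound : ∀ {k} → Symmetric G → Regular k G → ∀ {S} → IsGOA G S →
                      suc ⌊ k /2⌋ * ∣ ∁ S ∣ ≤ k * ∣ S ∣
  regular-GOA-bound {k} adj-sym regular {S} (_ , offensive) =
    double-count adj-sym S (∁ S) outside inside
    where
    δ+δ∁≡k : ∀ v → δ G S v + δ G (∁ S) v ≡ k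
    δ+δ∁≡k v = trans (δ+δ∁≡degree S v) (regular v)
    outside : ∀ v → v ∈ ∁ S → suc ⌊ k /2⌋ ≤ δ G S v
    outside v v∈∁S = subst (λ d → ⌊ d /2⌋ < δ G S v) (δ+δ∁≡k v)
      (⌊m+n/2⌋<m (subst (_≤ δ G S v) (+-comm _ 1) (offensive v (x∈∁p⇒x∉p v∈∁S))))
    inside : ∀ u → u ∈ S → δ G (∁ S) u ≤ k
    inside u _ = subst (δ G (∁ S) u ≤_) (δ+δ∁≡k u) (m≤n+m _ _)

module _ (G H : Graph) where

  private
    m = order G
    n = order H

  □-symmetric : Symmetric G → Symmetric H → Symmetric (G □ H)
  □-symmetric G-sym H-sym x y =
    cong₂ _∨_ (cong₂ _∧_ (⌊≟⌋-sym a c) (H-sym b d))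
              (cong₂ _∧_ (G-sym a c) (⌊≟⌋-sym b d))
    where
    a = proj₁ (remQuot {m} n x)
    b = proj₂ (remQuot {m} n x)
    c = proj₁ (remQuot {m} n y)
    d = proj₂ (remQuot {m} n y)

  𝟙-adj-□ : Loopless G → ∀ a c b d →
            𝟙 ((⌊ a ≟ c ⌋ ∧ adj H b d) ∨ (adj G a c ∧ ⌊ b ≟ d ⌋))
            ≡ 𝟙 ⌊ a ≟ c ⌋ * 𝟙 (adj H b d) + 𝟙 ⌊ b ≟ d ⌋ * 𝟙 (adj G a c)
  𝟙-adj-□ G-loopless a c b d = begin
    𝟙 ((⌊ a ≟ c ⌋ ∧ adj H b d) ∨ (adj G a c ∧ ⌊ b ≟ d ⌋))
      ≡⟨ 𝟙-∨ (⌊ a ≟ c ⌋ ∧ adj H b d) (adj G a c ∧ ⌊ b ≟ d ⌋) disjoint ⟩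
    𝟙 (⌊ a ≟ c ⌋ ∧ adj H b d) + 𝟙 (adj G a c ∧ ⌊ b ≟ d ⌋)
      ≡⟨ cong₂ _+_ (𝟙-∧ ⌊ a ≟ c ⌋ (adj H b d))
                   (trans (𝟙-∧ (adj G a c) ⌊ b ≟ d ⌋) (*-comm (𝟙 (adj G a c)) _)) ⟩
    𝟙 ⌊ a ≟ c ⌋ * 𝟙 (adj H b d) + 𝟙 ⌊ b ≟ d ⌋ * 𝟙 (adj G a c) ∎
    where
    open ≡-Reasoning
    disjoint : (⌊ a ≟ c ⌋ ∧ adj H b d) ∧ (adj G a c ∧ ⌊ b ≟ d ⌋) ≡ false
    disjoint with a ≟ c
    ... | no  _    = refl
    ... | yes refl rewrite G-loopless a = ∧-zeroʳ (adj H b d)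

  degree-□ : Loopless G → ∀ x →
             degree (G □ H) x
             ≡ degree G (proj₁ (remQuot {m} n x)) + degree H (proj₂ (remQuot {m} n x))
  degree-□ G-loopless x = begin
    degree (G □ H) x
      ≡⟨ count≡∑𝟙 (adj (G □ H) x) ⟩
    ∑[ y < m * n ] 𝟙 (adj (G □ H) x y)
      ≡⟨ ∑-remQuot m n (λ c d → 𝟙 (edge c d)) ⟩
    ∑[ c < m ] ∑[ d < n ] 𝟙 (edge c d)
      ≡⟨ sum-cong-≗ (λ c → sum-cong-≗ (𝟙-adj-□ G-loopless a c b)) ⟩
    ∑[ c < m ] ∑[ d < n ] (𝟙 ⌊ a ≟ c ⌋ * 𝟙 (adj H b d) + 𝟙 ⌊ b ≟ d ⌋ * 𝟙 (adj G a c))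
      ≡⟨ sum-cong-≗ (λ c → ∑-distrib-+ (λ d → 𝟙 ⌊ a ≟ c ⌋ * 𝟙 (adj H b d))
                                        (λ d → 𝟙 ⌊ b ≟ d ⌋ * 𝟙 (adj G a c))) ⟩
    ∑[ c < m ] (∑[ d < n ] (𝟙 ⌊ a ≟ c ⌋ * 𝟙 (adj H b d)) + ∑[ d < n ] (𝟙 ⌊ b ≟ d ⌋ * 𝟙 (adj G a c)))
      ≡⟨ sum-cong-≗ (λ c → cong₂ _+_ (sym (*-distribˡ-sum (𝟙 ⌊ a ≟ c ⌋) (𝟙 ∘ adj H b)))
                                      (∑-sift b (λ _ → 𝟙 (adj G a c)))) ⟩
    ∑[ c < m ] (𝟙 ⌊ a ≟ c ⌋ * ∑H + 𝟙 (adj G a c))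
      ≡⟨ ∑-distrib-+ (λ c → 𝟙 ⌊ a ≟ c ⌋ * ∑H) (𝟙 ∘ adj G a) ⟩
    ∑[ c < m ] (𝟙 ⌊ a ≟ c ⌋ * ∑H) + ∑[ c < m ] 𝟙 (adj G a c)
      ≡⟨ cong₂ _+_ (∑-sift a (λ _ → ∑H)) (sym (count≡∑𝟙 (adj G a))) ⟩
    ∑H + degree G a
      ≡⟨ cong (_+ degree G a) (sym (count≡∑𝟙 (adj H b))) ⟩
    degree H b + degree G a
      ≡⟨ +-comm (degree H b) (degree G a) ⟩
    degree G a + degree H b ∎
    where
    open ≡-Reasoning
    a = proj₁ (remQuot {m} n x)
    b = proj₂ (remQuot {m} n x)
    edge : Fin m → Fin n → Bool
    edge c d = (⌊ a ≟ c ⌋ ∧ adj H b d) ∨ (adj G a c ∧ ⌊ b ≟ d ⌋)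
    ∑H = ∑[ d < n ] 𝟙 (adj H b d)

  □-regular : ∀ {k l} → Loopless G → Regular k G → Regular l H → Regular (k + l) (G □ H)
  □-regular G-loopless G-regular H-regular x =
    trans (degree-□ G-loopless x) (cong₂ _+_ (G-regular _) (H-regular _))

-- The successor of a vertex of C n, literally as in the definition of C, so that
-- adj (C n) unfolds to it.
sucMod : ℕ → ℕ → ℕ
sucMod n a = if suc a == n then 0 else suc a

predMod : ℕ → ℕ → ℕ
predMod n zero    = pred n
predMod n (suc a) = a

-- In the lemmas below, matching on suc a ℕ.≟ n makes sucMod n a compute in the goal.
sucMod-last : ∀ a → sucMod (suc a) a ≡ 0
sucMod-last a with suc a ℕ.≟ suc a
... | yes _   = refl
... | no  a≢a = contradiction refl a≢a

sucMod-suc : ∀ {n a} → suc a ≢ n → sucMod n a ≡ suc a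
sucMod-suc {n} {a} 1+a≢n with suc a ℕ.≟ n
... | yes 1+a≡n = contradiction 1+a≡n 1+a≢n
... | no  _     = refl

sucMod-< : ∀ {n a} → a < n → sucMod n a < n
sucMod-< {n} {a} a<n with suc a ℕ.≟ n
... | yes refl  = z<s
... | no 1+a≢n = ≤∧≢⇒< a<n 1+a≢n

sucMod-injective : ∀ {n a b} → sucMod n a ≡ sucMod n b → a ≡ b
sucMod-injective {n} {a} {b} eq with suc a ℕ.≟ n | suc b ℕ.≟ n
... | yes refl | yes 1+b≡n = suc-injective (sym 1+b≡n)
... | yes refl | no  _     = contradiction eq λ ()
... | no _     | yes refl  = contradiction eq λ ()
... | no _     | no  _     = suc-injective eq

predMod-< : ∀ {n b} → b < n → predMod n b < n
predMod-< {suc n} {zero}  _     = n<1+n n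
predMod-< {n}     {suc b} 1+b<n = <⇒≤ 1+b<n

sucMod-predMod : ∀ {n b} → b < n → sucMod n (predMod n b) ≡ b
sucMod-predMod {suc n} {zero}  _     = sucMod-last n
sucMod-predMod {n}     {suc b} 1+b<n = sucMod-suc (<⇒≢ 1+b<n)

sucMod≢ : ∀ {n a} → 2 ≤ n → sucMod n a ≢ a
sucMod≢ {n} {a} 2≤n with suc a ℕ.≟ n
... | yes refl = <⇒≢ (s≤s⁻¹ 2≤n)
... | no _     = 1+n≢n

sucMod²≢ : ∀ {n a} → 3 ≤ n → sucMod n (sucMod n a) ≢ a
sucMod²≢ {n} {a} 3≤n with suc a ℕ.≟ n
... | yes refl = <⇒≢ (s≤s⁻¹ 3≤n) ∘ trans (sym (sucMod-suc 1≢n))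
  where 1≢n = <⇒≢ (≤-trans (n≤1+n 2) 3≤n)
... | no _ with suc (suc a) ℕ.≟ n
...   | yes refl = <⇒≢ (s≤s⁻¹ (s≤s⁻¹ 3≤n))
...   | no _     = m≢1+n+m a ∘ sym

module _ {n : ℕ} where

  next prev : Fin n → Fin n
  next i = fromℕ< (sucMod-< (toℕ<n i))
  prev i = fromℕ< (predMod-< (toℕ<n i))

  toℕ-next : ∀ i → toℕ (next i) ≡ sucMod n (toℕ i)
  toℕ-next i = toℕ-fromℕ< (sucMod-< (toℕ<n i))

  toℕ-prev : ∀ i → toℕ (prev i) ≡ predMod n (toℕ i)
  toℕ-prev i = toℕ-fromℕ< (predMod-< (toℕ<n i))

  sucMod-prev : ∀ i → sucMod n (toℕ (prev i)) ≡ toℕ i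
  sucMod-prev i = trans (cong (sucMod n) (toℕ-prev i)) (sucMod-predMod (toℕ<n i))

  adj-C : ∀ i j → adj (C n) i j ≡ ⌊ next i ≟ j ⌋ ∨ ⌊ prev i ≟ j ⌋
  adj-C i j = cong₂ _∨_ (⌊⌋-⇔ next⇔ (sucMod n (toℕ i) ℕ.≟ toℕ j) (next i ≟ j))
                        (⌊⌋-⇔ prev⇔ (sucMod n (toℕ j) ℕ.≟ toℕ i) (prev i ≟ j))
    where
    next⇔ : sucMod n (toℕ i) ≡ toℕ j ⇔ next i ≡ j
    next⇔ = mk⇔ (λ e → toℕ-injective (trans (toℕ-next i) e))
                (λ { refl → sym (toℕ-next i) })
    prev⇔ : sucMod n (toℕ j) ≡ toℕ i ⇔ prev i ≡ j
    prev⇔ = mk⇔ (λ e → toℕ-injective (sucMod-injective (trans (sucMod-prev i) (sym e))))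
                (λ { refl → sucMod-prev i })

C-symmetric : ∀ n → Symmetric (C n)
C-symmetric n i j = ∨-comm (sucMod n (toℕ i) == toℕ j) (sucMod n (toℕ j) == toℕ i)

C-loopless : ∀ {n} → 2 ≤ n → Loopless (C n)
C-loopless 2≤n i = cong (λ b → b ∨ b) (≢⇒==false (sucMod≢ 2≤n))

C-regular : ∀ {n} → 3 ≤ n → Regular 2 (C n)
C-regular {n} 3≤n i = trans (count-cong (adj-C i)) (count-≟-∨ next≢prev)
  where
  next≢prev : next i ≢ prev i
  next≢prev next≡prev = sucMod²≢ 3≤n (begin
    sucMod n (sucMod n (toℕ i)) ≡⟨ cong (sucMod n) (sym (toℕ-next i)) ⟩
    sucMod n (toℕ (next i))     ≡⟨ cong (sucMod n ∘ toℕ) next≡prev ⟩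
    sucMod n (toℕ (prev i))     ≡⟨ sucMod-prev i ⟩
    toℕ i                       ∎)
    where open ≡-Reasoning

isEven : ℕ → Bool
isEven zero    = true
isEven (suc a) = not (isEven a)

isEven-sucMod : ∀ {n a} → isEven a ≡ false → isEven (sucMod n a) ≡ true
isEven-sucMod {n} {a} odd with suc a ℕ.≟ n
... | yes _ = refl
... | no  _ = cong not odd

isEven-predMod : ∀ {n a} → isEven a ≡ false → isEven (predMod n a) ≡ true
isEven-predMod {a = suc a} odd = trans (sym (not-involutive (isEven a))) (cong not odd)

evens : (n : ℕ) → Subset n
evens n = tabulate (isEven ∘ toℕ)

evens-GOA : ∀ {n} → 3 ≤ n → IsGOA (C n) (evens n)
evens-GOA {suc n} 3≤n =
  (zero , here) , ∁-independent⇒offensive (C (suc n)) E degree-pos even-neighbours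
  where
  E = evens (suc n)
  lookup-E : ∀ i → lookup E i ≡ isEven (toℕ i)
  lookup-E = lookup∘tabulate (isEven ∘ toℕ)
  degree-pos : ∀ v → v ∉ E → 0 < degree (C (suc n)) v
  degree-pos v _ = subst (0 <_) (sym (C-regular 3≤n v)) z<s
  odd : ∀ {v} → v ∉ E → isEven (toℕ v) ≡ false
  odd {v} v∉E with isEven (toℕ v) in e
  ... | false = refl
  ... | true  = contradiction (lookup⇒[]= v E (trans (lookup-E v) e)) v∉E
  even : ∀ {u} → isEven (toℕ u) ≡ true → u ∈ E
  even {u} e = lookup⇒[]= u E (trans (lookup-E u) e)
  even-neighbours : ∀ v u → v ∉ E → adj (C (suc n)) v u ≡ true → u ∈ E
  even-neighbours v u v∉E v~u with ⌊⌋-∨ (next v ≟ u) (prev v ≟ u) (trans (sym (adj-C v u)) v~u)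
  ... | inj₁ refl = even (trans (cong isEven (toℕ-next v)) (isEven-sucMod {suc n} {toℕ v} (odd v∉E)))
  ... | inj₂ refl = even (trans (cong isEven (toℕ-prev v)) (isEven-predMod {suc n} {toℕ v} (odd v∉E)))

twice-count-even : ∀ n → 2 * count {n} (isEven ∘ toℕ) ≤ suc n
twice-count-odd  : ∀ n → 2 * count {n} (not ∘ isEven ∘ toℕ) ≤ n

twice-count-even zero    = z≤n
twice-count-even (suc n) = begin
  2 * suc (count {n} (not ∘ isEven ∘ toℕ)) ≡⟨ *-suc 2 (count {n} (not ∘ isEven ∘ toℕ)) ⟩
  2 + 2 * count {n} (not ∘ isEven ∘ toℕ)   ≤⟨ +-monoʳ-≤ 2 (twice-count-odd n) ⟩
  2 + n                                   ∎
  where open ≤-Reasoning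

twice-count-odd zero    = z≤n
twice-count-odd (suc n) =
  subst (λ c → 2 * c ≤ suc n) (count-cong {n} (λ i → sym (not-involutive (isEven (toℕ i)))))
        (twice-count-even n)

twice-∣evens∣≤1+n : ∀ n → 2 * ∣ evens n ∣ ≤ suc n
twice-∣evens∣≤1+n n =
  subst (λ c → 2 * c ≤ suc n) (sym ∣evens∣≡count) (twice-count-even n)
  where
  ∣evens∣≡count : ∣ evens n ∣ ≡ count {n} (isEven ∘ toℕ)
  ∣evens∣≡count = trans (∣p∣≡count (evens n)) (count-cong {n} (lookup∘tabulate (isEven ∘ toℕ)))

twice-γₒ[C]≤1+n : ∀ {n a} → 3 ≤ n → IsGammaO (C n) a → 2 * a ≤ suc n
twice-γₒ[C]≤1+n {n} 3≤n (_ , minimal) =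
  ≤-trans (*-monoʳ-≤ 2 (minimal (evens n) (evens-GOA 3≤n))) (twice-∣evens∣≤1+n n)

torus-GOA-bound : ∀ {r t} → 3 ≤ r → 3 ≤ t → ∀ {S} → IsGOA (C r □ C t) S →
                  3 * (r * t) ≤ 7 * ∣ S ∣
torus-GOA-bound {r} {t} 3≤r 3≤t {S} S-GOA = begin
  3 * (r * t)             ≡⟨ cong (3 *_) (sym (∣p∣+∣∁p∣≡n S)) ⟩
  3 * (∣ S ∣ + ∣ ∁ S ∣)   ≡⟨ *-distribˡ-+ 3 ∣ S ∣ ∣ ∁ S ∣ ⟩
  3 * ∣ S ∣ + 3 * ∣ ∁ S ∣ ≤⟨ +-monoʳ-≤ (3 * ∣ S ∣) ∁S-bound ⟩
  3 * ∣ S ∣ + 4 * ∣ S ∣   ≡⟨ sym (*-distribʳ-+ ∣ S ∣ 3 4) ⟩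
  7 * ∣ S ∣               ∎
  where
  open ≤-Reasoning
  torus-symmetric : Symmetric (C r □ C t)
  torus-symmetric = □-symmetric (C r) (C t) (C-symmetric r) (C-symmetric t)
  torus-regular : Regular 4 (C r □ C t)
  torus-regular =
    □-regular (C r) (C t) (C-loopless (≤-trans (n≤1+n 2) 3≤r)) (C-regular 3≤r) (C-regular 3≤t)
  ∁S-bound : 3 * ∣ ∁ S ∣ ≤ 4 * ∣ S ∣
  ∁S-bound = regular-GOA-bound (C r □ C t) torus-symmetric torus-regular S-GOA

7*[1+r]*[1+t]≤4+12*r*t : ∀ {r t} → 3 ≤ r → 3 ≤ t → 7 * (suc r * suc t) ≤ 4 + 12 * (r * t)
7*[1+r]*[1+t]≤4+12*r*t {r = suc (suc (suc x))} {t = suc (suc (suc y))}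
                       (s≤s (s≤s (s≤s _))) (s≤s (s≤s (s≤s _))) =
  subst (7 * ((4 + x) * (4 + y)) ≤_) (expand x y) (m≤m+n _ _)
  where
  expand : ∀ x y → 7 * ((4 + x) * (4 + y)) + (8 * x + 8 * y + 5 * (x * y))
                 ≡ 4 + 12 * ((3 + x) * (3 + y))
  expand = solve-∀

-- The rational inequality (r+1)(t+1)/4 ≤ 3rt/7 fails at r = t = 3; it is the
-- integrality of a * b and c that absorbs the slack 4 < 28 below.
a*b≤c : ∀ {r t a b c} → 3 ≤ r → 3 ≤ t →
        2 * a ≤ suc r → 2 * b ≤ suc t → 3 * (r * t) ≤ 7 * c → a * b ≤ c
a*b≤c {r} {t} {a} {b} {c} 3≤r 3≤t 2a≤1+r 2b≤1+t 3rt≤7c =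
  m<1+n⇒m≤n (*-cancelˡ-< 28 (a * b) (suc c) (begin-strict
  28 * (a * b)          ≡⟨ regroup a b ⟩
  7 * (2 * a * (2 * b)) ≤⟨ *-monoʳ-≤ 7 (*-mono-≤ 2a≤1+r 2b≤1+t) ⟩
  7 * (suc r * suc t)   ≤⟨ 7*[1+r]*[1+t]≤4+12*r*t 3≤r 3≤t ⟩
  4 + 12 * (r * t)      ≡⟨ cong (4 +_) (*-assoc 4 3 (r * t)) ⟩
  4 + 4 * (3 * (r * t)) ≤⟨ +-monoʳ-≤ 4 (*-monoʳ-≤ 4 3rt≤7c) ⟩
  4 + 4 * (7 * c)       ≡⟨ cong (4 +_) (sym (*-assoc 4 7 c)) ⟩
  4 + 28 * c            <⟨ +-monoˡ-< (28 * c) (m≤m+n 5 23) ⟩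
  28 + 28 * c           ≡⟨ sym (*-suc 28 c) ⟩
  28 * suc c            ∎))
  where
  open ≤-Reasoning
  regroup : ∀ a b → 28 * (a * b) ≡ 7 * (2 * a * (2 * b))
  regroup = solve-∀

corollary18 : ∀ (r t : ℕ) → 3 ≤ r → 3 ≤ t →
              ∀ (a b c : ℕ) → IsGammaO (C r) a → IsGammaO (C t) b →
              IsGammaO (C r □ C t) c → a * b ≤ c
corollary18 r t 3≤r 3≤t a b c γₒ-Cr γₒ-Ct ((S , S-GOA , ∣S∣≡c) , _) =
  a*b≤c {a = a} {b} {c} 3≤r 3≤t
    (twice-γₒ[C]≤1+n 3≤r γₒ-Cr) (twice-γₒ[C]≤1+n 3≤t γₒ-Ct)
    (subst (λ s → 3 * (r * t) ≤ 7 * s) ∣S∣≡c (torus-GOA-bound 3≤r 3≤t S-GOA))
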